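{- Let $E$ be a finite set, let $\operatorname{Shade}:\mathcal{P}(E)\to\mathcal{P}(E)$ be an inclusion-preserving shade map on $E$, and let $G\subseteq E$. Let $\mathcal{A}=\{F\subseteq E\mid G\not\subseteq\operatorname{Shade}F\}$. Then (a) $\mathcal{A}$ is a simplicial complex on ground set $E$; (b) $\mathcal{A}$ is collapsible.
   Context: $\mathcal{P}(E)$ is the power set of $E$. A map $S:\mathcal{P}(E)\to\mathcal{P}(E)$ is inclusion-preserving if $A\subseteq B$ implies $S(A)\subseteq S(B)$. A shade map on $E$ is a map $S:\mathcal{P}(E)\to\mathcal{P}(E)$ such that for every $F\subseteq E$ and every $u\in E\setminus S(F)$ we have $S(F\cup\{u\})=S(F)$ and $S(F\setminus\{u\})=S(F)$. A simplicial complex on finite ground set $E$ is a set $\mathcal{A}$ of subsets of $E$ with $P\in\mathcal{A}$, $Q\subseteq P$ implying $Q\in\mathcal{A}$. For sets $A,B$ write $A\prec B$ if $A\subseteq B$ and $|B\setminus A|=1$. A complete matching of $\mathcal{A}$ is a map $\mu:\mathcal{A}\to\mathcal{A}$ with $\mu\circ\mu=\mathrm{id}$ such that for each $F\in\mathcal{A}$ either $\mu(F)\prec F$ or $F\prec\mu(F)$. It is acyclic if there is no tuple $(B_1,\ldots,B_n)$ of distinct sets in $\mathcal{A}$ with $n\ge2$, $\mu(B_i)\prec B_i$ for all $i\le n$, $\mu(B_i)\prec B_{i+1}$ for $i\le n-1$, and $\mu(B_n)\prec B_1$. $\mathcal{A}$ is collapsible if it has an acyclic complete matching. -}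

module Defs where

open import Data.Nat using (ℕ; _≤_; suc)
open import Data.Fin using (Fin; toℕ)
open import Data.Fin.Subset using (Subset; _∈_; _∉_; _⊆_; _∪_; _-_; _─_; ⁅_⁆; ∣_∣)
open import Data.Product using (Σ; _×_; ∃)
open import Data.Sum using (_⊎_)
open import Relation.Binary.PropositionalEquality using (_≡_)
open import Relation.Nullary using (¬_)

-- The ground set E is modelled as Fin n; P(E) is Subset n.

InclusionPreserving : ∀ {n} → (Subset n → Subset n) → Set
InclusionPreserving S = ∀ A B → A ⊆ B → S A ⊆ S B

IsShadeMap : ∀ {n} → (Subset n → Subset n) → Set
IsShadeMap {n} S = ∀ (F : Subset n) (u : Fin n) → u ∉ S F →
  (S (F ∪ ⁅ u ⁆) ≡ S F) × (S (F - u) ≡ S F)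

Family : ℕ → Set₁
Family n = Subset n → Set

IsSimplicialComplex : ∀ {n} → Family n → Set
IsSimplicialComplex {n} 𝒜 = ∀ (P Q : Subset n) → 𝒜 P → Q ⊆ P → 𝒜 Q

_≺_ : ∀ {n} → Subset n → Subset n → Set
A ≺ B = A ⊆ B × ∣ B ─ A ∣ ≡ 1

IsCompleteMatching : ∀ {n} → Family n → (Subset n → Subset n) → Set
IsCompleteMatching 𝒜 μ =
  (∀ F → 𝒜 F → 𝒜 (μ F)) ×
  (∀ F → 𝒜 F → μ (μ F) ≡ F) ×
  (∀ F → 𝒜 F → (μ F ≺ F) ⊎ (F ≺ μ F))

-- A cycle (B₁,…,Bₘ) of distinct members of 𝒜, m ≥ 2, indexed by Fin m
-- (index 0 is B₁), with μ(Bᵢ) ≺ Bᵢ for all i, μ(Bᵢ) ≺ Bᵢ₊₁ for i < m,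
-- and μ(Bₘ) ≺ B₁.
IsCycle : ∀ {n} → Family n → (Subset n → Subset n) → (m : ℕ) → (Fin m → Subset n) → Set
IsCycle 𝒜 μ m B =
  2 ≤ m ×
  (∀ i j → B i ≡ B j → i ≡ j) ×
  (∀ i → 𝒜 (B i)) ×
  (∀ i → μ (B i) ≺ B i) ×
  (∀ (i j : Fin m) → toℕ j ≡ suc (toℕ i) → μ (B i) ≺ B j) ×
  (∀ (i j : Fin m) → suc (toℕ i) ≡ m → toℕ j ≡ 0 → μ (B i) ≺ B j)

IsAcyclic : ∀ {n} → Family n → (Subset n → Subset n) → Set
IsAcyclic 𝒜 μ = ∀ m B → ¬ IsCycle 𝒜 μ m B

Collapsible : ∀ {n} → Family n → Set
Collapsible {n} 𝒜 = Σ (Subset n → Subset n) λ μ → IsCompleteMatching 𝒜 μ × IsAcyclic 𝒜 μ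

NotShadedFamily : ∀ {n} → (Subset n → Subset n) → Subset n → Family n
NotShadedFamily S G F = ¬ (G ⊆ S F)

-- Let g be some element of E outside Shade F, chosen as a function of Shade F
-- alone, and match F with F △ {g}.  The shade axiom gives
-- Shade (F △ {g}) = Shade F, so this is a complete matching of 𝒜.  Along a
-- cycle B₁, …, Bₘ we have Shade Bᵢ = Shade (μ Bᵢ) ⊆ Shade Bᵢ₊₁ by monotonicity,
-- so all the Bᵢ have the same shade and hence the same g.  Then B₁ and B₂ both
-- cover μ B₁ = B₁ ∖ {g} by adding g, forcing B₁ = B₂.
module Submission where

open import Defs
open import Data.Nat using (ℕ; zero; suc; _≤_; _<_; z≤n; s≤s)
open import Data.Nat.Properties using (≤-<-trans; <-irrefl; n<1⇒n≡0; m≤n⇒m<n∨m≡n; <⇒≤)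
open import Data.Fin using (Fin; zero; suc; toℕ; fromℕ; fromℕ<)
open import Data.Fin.Properties using (any?; toℕ-injective; toℕ-fromℕ<; toℕ-fromℕ; toℕ<n)
  renaming (_≟_ to _≟ᶠ_)
open import Data.Fin.Subset using (Subset; inside; outside; _∈_; _∉_; _⊆_; _∪_; _─_; _-_; ⁅_⁆; ∣_∣)
open import Data.Fin.Subset.Properties
  using (_∈?_; ⊆-antisym; ⊆-trans; ⊆-refl; p─q⊆p; x∈p∧x∉q⇒x∈p─q; x∈p∧x≢y⇒x∈p-y;
         x∈p⇒∣p-x∣<∣p∣; x∈p∪q⁺; x∈p∪q⁻; x∈⁅x⁆; x∈⁅y⁆⇒x≡y; ∣⁅x⁆∣≡1)
open import Data.Vec using (_∷_; there)
open import Data.Maybe using (Maybe; just; nothing; maybe′)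
open import Data.Product using (_×_; _,_; ∃; proj₁; proj₂)
open import Data.Sum using (_⊎_; inj₁; inj₂)
import Data.Sum as Sum
open import Function using (_∘_)
open import Relation.Binary.Core using (Rel)
open import Relation.Binary.Definitions using (Reflexive; Transitive)
open import Relation.Binary.PropositionalEquality
  using (_≡_; _≢_; refl; sym; trans; cong; subst; module ≡-Reasoning)
open import Relation.Nullary using (¬_; yes; no; contradiction)
open import Relation.Nullary.Decidable using (¬?; decidable-stable; toSum)

private
  variable
    n : ℕ
    x y g : Fin n
    p q A B C F T : Subset n

x∈p─q⇒x∉q : x ∈ p ─ q → x ∉ q
x∈p─q⇒x∉q {p = _ ∷ _} {q = outside ∷ _} (there x∈p─q) (there x∈q) = x∈p─q⇒x∉q x∈p─q x∈q
x∈p─q⇒x∉q {p = _ ∷ _} {q = inside ∷ _}  (there x∈p─q) (there x∈q) = x∈p─q⇒x∉q x∈p─q x∈q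

∣p∣≡1⇒∈-unique : ∣ p ∣ ≡ 1 → x ∈ p → y ∈ p → x ≡ y
∣p∣≡1⇒∈-unique {p = p} {x = x} {y = y} ∣p∣≡1 x∈p y∈p with x ≟ᶠ y
... | yes x≡y = x≡y
... | no x≢y = contradiction (subst (0 <_) (n<1⇒n≡0 ∣p-x∣<1) 0<∣p-x∣) (<-irrefl refl)
  where
  ∣p-x∣<1 : ∣ p - x ∣ < 1
  ∣p-x∣<1 = subst (∣ p - x ∣ <_) ∣p∣≡1 (x∈p⇒∣p-x∣<∣p∣ x∈p)
  0<∣p-x∣ : 0 < ∣ p - x ∣
  0<∣p-x∣ = ≤-<-trans z≤n (x∈p⇒∣p-x∣<∣p∣ (x∈p∧x≢y⇒x∈p-y y∈p (x≢y ∘ sym)))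

≺-intro : A ⊆ B → g ∉ A → g ∈ B → (∀ {x} → x ∈ B → x ∉ A → x ≡ g) → A ≺ B
≺-intro {A = A} {B = B} {g = g} A⊆B g∉A g∈B new≡g = A⊆B , trans (cong ∣_∣ B─A≡⁅g⁆) (∣⁅x⁆∣≡1 g)
  where
  B─A≡⁅g⁆ : B ─ A ≡ ⁅ g ⁆
  B─A≡⁅g⁆ = ⊆-antisym
    (λ x∈B─A → subst (_∈ ⁅ g ⁆) (sym (new≡g (p─q⊆p B A x∈B─A) (x∈p─q⇒x∉q x∈B─A))) (x∈⁅x⁆ g))
    (λ x∈⁅g⁆ → subst (_∈ B ─ A) (sym (x∈⁅y⁆⇒x≡y g x∈⁅g⁆)) (x∈p∧x∉q⇒x∈p─q g∈B g∉A))

≺-new-unique : A ≺ B → x ∈ B → x ∉ A → y ∈ B → y ∉ A → x ≡ y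
≺-new-unique (_ , ∣B─A∣≡1) x∈B x∉A y∈B y∉A =
  ∣p∣≡1⇒∈-unique ∣B─A∣≡1 (x∈p∧x∉q⇒x∈p─q x∈B x∉A) (x∈p∧x∉q⇒x∈p─q y∈B y∉A)

≺-cover-unique : A ≺ B → A ≺ C → g ∉ A → g ∈ B → g ∈ C → B ≡ C
≺-cover-unique A≺B A≺C g∉A g∈B g∈C =
  ⊆-antisym (⊆-cover A≺B (proj₁ A≺C) g∉A g∈B g∈C) (⊆-cover A≺C (proj₁ A≺B) g∉A g∈C g∈B)
  where
  ⊆-cover : A ≺ B → A ⊆ C → g ∉ A → g ∈ B → g ∈ C → B ⊆ C
  ⊆-cover {A = A} A≺B A⊆C g∉A g∈B g∈C {x} x∈B with x ∈? A
  ... | yes x∈A = A⊆C x∈A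
  ... | no x∉A = subst (_∈ _) (sym (≺-new-unique A≺B x∈B x∉A g∈B g∉A)) g∈C

toggle : Subset n → Fin n → Subset n
toggle F g with g ∈? F
... | yes _ = F - g
... | no  _ = F ∪ ⁅ g ⁆

∉⇒∈-toggle : g ∉ F → g ∈ toggle F g
∉⇒∈-toggle {g = g} {F = F} g∉F with g ∈? F
... | yes g∈F = contradiction g∈F g∉F
... | no  _   = x∈p∪q⁺ (inj₂ (x∈⁅x⁆ g))

∈⇒∉-toggle : g ∈ F → g ∉ toggle F g
∈⇒∉-toggle {g = g} {F = F} g∈F with g ∈? F
... | yes _   = λ g∈F-g → x∈p─q⇒x∉q g∈F-g (x∈⁅x⁆ g)
... | no  g∉F = contradiction g∈F g∉F

∈-toggle⁺ : x ≢ g → x ∈ F → x ∈ toggle F g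
∈-toggle⁺ {g = g} {F = F} x≢g x∈F with g ∈? F
... | yes _ = x∈p∧x≢y⇒x∈p-y x∈F x≢g
... | no  _ = x∈p∪q⁺ (inj₁ x∈F)

∈-toggle⁻ : x ≢ g → x ∈ toggle F g → x ∈ F
∈-toggle⁻ {g = g} {F = F} x≢g x∈F△g with g ∈? F
... | yes _ = p─q⊆p F ⁅ g ⁆ x∈F△g
... | no  _ with x∈p∪q⁻ F ⁅ g ⁆ x∈F△g
...   | inj₁ x∈F  = x∈F
...   | inj₂ x∈⁅g⁆ = contradiction (x∈⁅y⁆⇒x≡y g x∈⁅g⁆) x≢g

toggle-involutive : ∀ (F : Subset n) g → toggle (toggle F g) g ≡ F
toggle-involutive F g = ⊆-antisym ⊆F F⊆
  where
  ⊆F : toggle (toggle F g) g ⊆ F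
  ⊆F {x} x∈F△g△g with x ≟ᶠ g
  ... | yes refl = decidable-stable (g ∈? F) (λ g∉F → ∈⇒∉-toggle (∉⇒∈-toggle g∉F) x∈F△g△g)
  ... | no x≢g   = ∈-toggle⁻ x≢g (∈-toggle⁻ x≢g x∈F△g△g)
  F⊆ : F ⊆ toggle (toggle F g) g
  F⊆ {x} x∈F with x ≟ᶠ g
  ... | yes refl = ∉⇒∈-toggle (∈⇒∉-toggle x∈F)
  ... | no x≢g   = ∈-toggle⁺ x≢g (∈-toggle⁺ x≢g x∈F)

toggle-≺ : g ∈ F → toggle F g ≺ F
toggle-≺ {g = g} {F = F} g∈F = ≺-intro ⊆F (∈⇒∉-toggle g∈F) g∈F new≡g
  where
  ⊆F : toggle F g ⊆ F
  ⊆F {x} x∈F△g with x ≟ᶠ g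
  ... | yes refl = g∈F
  ... | no x≢g   = ∈-toggle⁻ x≢g x∈F△g
  new≡g : x ∈ F → x ∉ toggle F g → x ≡ g
  new≡g {x = x} x∈F x∉F△g with x ≟ᶠ g
  ... | yes x≡g = x≡g
  ... | no x≢g  = contradiction (∈-toggle⁺ x≢g x∈F) x∉F△g

toggle-≻ : g ∉ F → F ≺ toggle F g
toggle-≻ {g = g} {F = F} g∉F =
  subst (_≺ toggle F g) (toggle-involutive F g) (toggle-≺ (∉⇒∈-toggle g∉F))

toggle-≺⊎≻ : (toggle F g ≺ F) ⊎ (F ≺ toggle F g)
toggle-≺⊎≻ {F = F} {g = g} = Sum.map toggle-≺ toggle-≻ (toSum (g ∈? F))

toggle-⊆⇒∈ : toggle F g ⊆ F → g ∈ F
toggle-⊆⇒∈ {F = F} {g = g} F△g⊆F =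
  decidable-stable (g ∈? F) (λ g∉F → g∉F (F△g⊆F (∉⇒∈-toggle g∉F)))

toggle-cover-unique : toggle A g ≺ A → toggle A g ≺ B → toggle B g ≺ B → A ≡ B
toggle-cover-unique {A = A} {g = g} {B = B} A△g≺A A△g≺B B△g≺B =
  ≺-cover-unique A△g≺A A△g≺B (∈⇒∉-toggle g∈A) g∈A g∈B
  where
  g∈A : g ∈ A
  g∈A = toggle-⊆⇒∈ {g = g} (proj₁ A△g≺A)
  g∈B : g ∈ B
  g∈B = toggle-⊆⇒∈ {g = g} (proj₁ B△g≺B)

shade-toggle : ∀ {S : Subset n → Subset n} → IsShadeMap S → g ∉ S F → S (toggle F g) ≡ S F
shade-toggle {g = g} {F = F} shade g∉SF with g ∈? F
... | yes _ = proj₂ (shade F g g∉SF)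
... | no  _ = proj₁ (shade F g g∉SF)

module _ {a ℓ} {A : Set a} {_∼_ : Rel A ℓ} (∼-refl : Reflexive _∼_) (∼-trans : Transitive _∼_) where

  chain-monotone : ∀ {m} (X : Fin m → A) → (∀ i j → toℕ j ≡ suc (toℕ i) → X i ∼ X j) →
                   ∀ i j → toℕ i ≤ toℕ j → X i ∼ X j
  chain-monotone {m} X step i j i≤j = go (toℕ j) j refl i≤j
    where
    go : ∀ k j → toℕ j ≡ k → toℕ i ≤ k → X i ∼ X j
    go k j j≡k i≤k with m≤n⇒m<n∨m≡n i≤k
    go k       j j≡k   _ | inj₂ i≡k       =
      subst (λ j → X i ∼ X j) (toℕ-injective (trans i≡k (sym j≡k))) ∼-refl
    go (suc k) j j≡1+k _ | inj₁ (s≤s i≤k) =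
      ∼-trans (go k j′ (toℕ-fromℕ< k<m) i≤k) (step j′ j j≡1+j′)
      where
      k<m : k < m
      k<m = <⇒≤ (subst (_< m) j≡1+k (toℕ<n j))
      j′ : Fin m
      j′ = fromℕ< k<m
      j≡1+j′ : toℕ j ≡ suc (toℕ j′)
      j≡1+j′ = trans j≡1+k (cong suc (sym (toℕ-fromℕ< k<m)))

pivot : Subset n → Maybe (Fin n)
pivot T with any? (λ g → ¬? (g ∈? T))
... | yes (g , _) = just g
... | no  _       = nothing

⊈⇒pivot-∉ : ¬ (p ⊆ T) → ∃ λ g → pivot T ≡ just g × g ∉ T
⊈⇒pivot-∉ {T = T} p⊈T with any? (λ g → ¬? (g ∈? T))
... | yes (g , g∉T) = g , refl , g∉T
... | no  ∄∉T       =
  contradiction (λ {x} _ → decidable-stable (x ∈? T) (λ x∉T → ∄∉T (x , x∉T))) p⊈T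

module ShadeMatching (S : Subset n → Subset n) (mono : InclusionPreserving S) (shade : IsShadeMap S)
                     (G : Subset n) where

  𝒜 : Family n
  𝒜 = NotShadedFamily S G

  𝒜-down-closed : IsSimplicialComplex 𝒜
  𝒜-down-closed P Q P∈𝒜 Q⊆P G⊆SQ = P∈𝒜 (⊆-trans G⊆SQ (mono Q P Q⊆P))

  μ : Subset n → Subset n
  μ F = maybe′ (toggle F) F (pivot (S F))

  μ-toggles : 𝒜 F → ∃ λ g → g ∉ S F × (∀ {F′} → S F′ ≡ S F → μ F′ ≡ toggle F′ g)
  μ-toggles F∈𝒜 with ⊈⇒pivot-∉ F∈𝒜
  ... | g , pivot≡g , g∉SF =
    g , g∉SF , λ {F′} SF′≡SF → cong (maybe′ (toggle F′) F′) (trans (cong pivot SF′≡SF) pivot≡g)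

  shade-μ : 𝒜 F → S (μ F) ≡ S F
  shade-μ {F = F} F∈𝒜 with μ-toggles F∈𝒜
  ... | g , g∉SF , μ≡toggle = trans (cong S (μ≡toggle refl)) (shade-toggle shade g∉SF)

  μ-complete-matching : IsCompleteMatching 𝒜 μ
  μ-complete-matching = μ-closed , μ-involutive , μ-≺⊎≻
    where
    μ-closed : ∀ F → 𝒜 F → 𝒜 (μ F)
    μ-closed F F∈𝒜 = subst (λ T → ¬ (G ⊆ T)) (sym (shade-μ F∈𝒜)) F∈𝒜
    μ-involutive : ∀ F → 𝒜 F → μ (μ F) ≡ F
    μ-involutive F F∈𝒜 with μ-toggles F∈𝒜
    ... | g , _ , μ≡toggle = begin
      μ (μ F)               ≡⟨ μ≡toggle (shade-μ F∈𝒜) ⟩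
      toggle (μ F) g        ≡⟨ cong (λ F′ → toggle F′ g) (μ≡toggle refl) ⟩
      toggle (toggle F g) g ≡⟨ toggle-involutive F g ⟩
      F                     ∎
      where open ≡-Reasoning
    μ-≺⊎≻ : ∀ F → 𝒜 F → (μ F ≺ F) ⊎ (F ≺ μ F)
    μ-≺⊎≻ F F∈𝒜 with μ-toggles F∈𝒜
    ... | g , _ , μ≡toggle =
      subst (λ F′ → (F′ ≺ F) ⊎ (F ≺ F′)) (sym (μ≡toggle refl)) (toggle-≺⊎≻ {g = g})

  shade-grows-along-≺ : 𝒜 A → μ A ≺ C → S A ⊆ S C
  shade-grows-along-≺ {A = A} {C = C} A∈𝒜 (μA⊆C , _) =
    subst (_⊆ S C) (shade-μ A∈𝒜) (mono (μ A) C μA⊆C)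

  cycle-shade-constant : ∀ {m} {B : Fin (suc (suc m)) → Subset n} →
                         IsCycle 𝒜 μ (suc (suc m)) B → S (B zero) ≡ S (B (suc zero))
  cycle-shade-constant {m} {B} (_ , _ , B∈𝒜 , _ , next , wrap) =
    ⊆-antisym (edge zero (suc zero) refl) (⊆-trans S₁⊆Sₘ (shade-grows-along-≺ (B∈𝒜 last) Bₘ→B₀))
    where
    edge : ∀ i j → toℕ j ≡ suc (toℕ i) → S (B i) ⊆ S (B j)
    edge i j j≡1+i = shade-grows-along-≺ (B∈𝒜 i) (next i j j≡1+i)
    last : Fin (suc (suc m))
    last = fromℕ (suc m)
    S₁⊆Sₘ : S (B (suc zero)) ⊆ S (B last)
    S₁⊆Sₘ = chain-monotone {_∼_ = _⊆_} ⊆-refl ⊆-trans (S ∘ B) edge (suc zero) last (s≤s z≤n)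
    Bₘ→B₀ : μ (B last) ≺ B zero
    Bₘ→B₀ = wrap last zero (cong suc (toℕ-fromℕ (suc m))) refl

  μ-acyclic : IsAcyclic 𝒜 μ
  μ-acyclic 0 B (() , _)
  μ-acyclic 1 B (s≤s () , _)
  μ-acyclic (suc (suc m)) B cycle@(_ , B-injective , B∈𝒜 , down , next , _)
    with μ-toggles (B∈𝒜 zero)
  ... | g , _ , μ≡toggle = 0≢1 (B-injective zero (suc zero) B₀≡B₁)
    where
    B₀ B₁ : Subset n
    B₀ = B zero
    B₁ = B (suc zero)
    μB₀ : μ B₀ ≡ toggle B₀ g
    μB₀ = μ≡toggle refl
    μB₁ : μ B₁ ≡ toggle B₁ g
    μB₁ = μ≡toggle (sym (cycle-shade-constant cycle))
    B₀≡B₁ : B₀ ≡ B₁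
    B₀≡B₁ = toggle-cover-unique {g = g} (subst (_≺ B₀) μB₀ (down zero))
                                (subst (_≺ B₁) μB₀ (next zero (suc zero) refl))
                                (subst (_≺ B₁) μB₁ (down (suc zero)))
    0≢1 : zero ≢ suc {suc m} zero
    0≢1 ()

theorem5p7 : ∀ (n : ℕ) (Shade : Subset n → Subset n) (G : Subset n) →
    InclusionPreserving Shade → IsShadeMap Shade →
    IsSimplicialComplex (NotShadedFamily Shade G) × Collapsible (NotShadedFamily Shade G)
theorem5p7 n Shade G mono shade = 𝒜-down-closed , μ , μ-complete-matching , μ-acyclic
  where open ShadeMatching Shade mono shade G
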